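{- For all formulas $\phi,\chi$: if there is a tableaux proof of $\phi\vdash_{\mathrm{NFL}_{\mathbf{M3}}}\chi$ (in the calculus described in the context), then $\phi\vDash_{\mathrm{NFL}_{\mathbf{M3}}}\chi$.
   Context: Semantics: $\mathbf{M3}$ is the lattice on $\{\mathbf{T},\mathbf{B},\mathbf{0},\mathbf{N},\mathbf{F}\}$ with top $\mathbf{T}$, bottom $\mathbf{F}$ and three pairwise incomparable middle elements $\mathbf{B},\mathbf{0},\mathbf{N}$. Formulas are built from propositional variables using $\neg,\wedge,\vee$; a valuation maps variables to $\mathbf{M3}$ and is extended by interpreting $\wedge,\vee$ as meet and join of $\mathbf{M3}$ and $\neg$ by $\neg\mathbf{T}=\mathbf{F}$, $\neg\mathbf{F}=\mathbf{T}$, $\neg x=x$ for $x\in\{\mathbf{B},\mathbf{0},\mathbf{N}\}$. $\phi\vDash_{\mathrm{NFL}_{\mathbf{M3}}}\chi$ iff for every valuation $v$, $v(\phi)\neq\mathbf{F}$ implies $v(\chi)\neq\mathbf{F}$. Tableaux: a tableau is a downward branching tree whose nodes contain labelled formulas $\mathfrak{t}[\phi]$, $\mathfrak{m}[\phi]$, $\mathfrak{f}[\phi]$ and labelled pairs $\phi\sim\chi$, $\phi\nsim\chi$; branches are regarded as sets. A branch containing the premise(s) of a rule may be extended by the rule; conclusions separated by $\mid$ split the branch. Rules ($i\in\{1,2\}$, $p,q,r$ propositional variables, $\circ\in\{\wedge,\vee\}$): $(\mathfrak{t}\wedge)$: $\mathfrak{t}[\phi\wedge\chi]$ / $\mathfrak{t}[\phi],\mathfrak{t}[\chi]$.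 $(\mathfrak{t}\vee)$: $\mathfrak{t}[\phi\vee\chi]$ / $\mathfrak{t}[\phi]\mid\mathfrak{t}[\chi]\mid\mathfrak{m}[\phi],\mathfrak{m}[\chi],\phi\nsim\chi$. $(\mathfrak{t}\neg)$: $\mathfrak{t}[\neg\phi]$ / $\mathfrak{f}[\phi]$. $(\mathfrak{m}\wedge)$: $\mathfrak{m}[\phi\wedge\chi]$ / $\mathfrak{t}[\phi],\mathfrak{m}[\chi]\mid\mathfrak{m}[\phi],\mathfrak{t}[\chi]\mid\mathfrak{m}[\phi],\mathfrak{m}[\chi],\phi\sim\chi$. $(\mathfrak{m}\vee)$: $\mathfrak{m}[\phi\vee\chi]$ / $\mathfrak{f}[\phi],\mathfrak{m}[\chi]\mid\mathfrak{m}[\phi],\mathfrak{f}[\chi]\mid\mathfrak{m}[\phi],\mathfrak{m}[\chi],\phi\sim\chi$. $(\mathfrak{m}\neg)$: $\mathfrak{m}[\neg\phi]$ / $\mathfrak{m}[\phi],\phi\sim\neg\phi$. $(\mathfrak{f}\wedge)$: $\mathfrak{f}[\phi\wedge\chi]$ / $\mathfrak{f}[\phi]\mid\mathfrak{f}[\chi]\mid\mathfrak{m}[\phi],\mathfrak{m}[\chi],\phi\nsim\chi$. $(\mathfrak{f}\vee)$: $\mathfrak{f}[\phi\vee\chi]$ / $\mathfrak{f}[\phi],\mathfrak{f}[\chi]$. $(\mathfrak{f}\neg)$: $\mathfrak{f}[\neg\phi]$ / $\mathfrak{t}[\phi]$. $(\sim\mathsf{sym})$: $\phi\sim\chi$ /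 $\chi\sim\phi$; $(\nsim\mathsf{sym})$: $\phi\nsim\chi$ / $\chi\nsim\phi$. $(\sim\mathsf{trans})$: $p\sim q,q\sim r$ / $p\sim r$; $(\nsim\mathsf{trans})$: $p\nsim q,q\sim r$ / $p\nsim r$. $(\neg\sim)$: $\neg\phi\sim\chi$ / $\phi\sim\chi$; $(\neg\nsim)$: $\neg\phi\nsim\chi$ / $\phi\nsim\chi$. $(\circ\sim)$: $\phi\sim\chi_1\circ\chi_2,\mathfrak{m}[\chi_i]$ / $\phi\sim\chi_i$; $(\circ\nsim)$: $\phi\nsim\chi_1\circ\chi_2,\mathfrak{m}[\chi_i]$ / $\phi\nsim\chi_i$. A branch is closed iff it contains one of: (1) $\mathcal{M}[\phi]$ and $\mathcal{M}'[\phi]$ for distinct labels $\mathcal{M},\mathcal{M}'\in\{\mathfrak{t},\mathfrak{m},\mathfrak{f}\}$; (2) $\phi\sim\chi$ and $\phi\nsim\chi$; (3) $\phi\nsim\phi$; (4) formulas $\phi_1,\ldots,\phi_4$ with $\phi_i\nsim\phi_j$ for all $1\le i<j\le 4$. A tableau is closed iff all its branches are closed. There is a tableaux proof of $\phi\vdash_{\mathrm{NFL}_{\mathbf{M3}}}\chi$ iff there are closed tableaux beginning with $\{\mathfrak{m}[\phi],\mathfrak{f}[\chi]\}$ and with $\{\mathfrak{t}[\phi],\mathfrak{f}[\chi]\}$. -}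

module Defs where

open import Data.Nat using (ℕ)
open import Data.List using (List; []; _∷_; _++_)
open import Data.List.Membership.Propositional using (_∈_)
open import Data.List.Relation.Unary.All using (All)
open import Data.Product using (_×_)
open import Relation.Binary.PropositionalEquality using (_≡_; _≢_)

infixr 6 _∧'_
infixr 5 _∨'_

data Formula : Set where
  var  : ℕ → Formula
  ¬'_  : Formula → Formula
  _∧'_ : Formula → Formula → Formula
  _∨'_ : Formula → Formula → Formula

-- The lattice M3: top T, bottom F, three incomparable middles B, O (= 0), N

data M3 : Set where
  T B O N F : M3

_⊓_ : M3 → M3 → M3
T ⊓ y = y
F ⊓ y = F
B ⊓ T = B
B ⊓ B = B
B ⊓ _ = F
O ⊓ T = O
O ⊓ O = O
O ⊓ _ = F
N ⊓ T = N
N ⊓ N = N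
N ⊓ _ = F

_⊔_ : M3 → M3 → M3
F ⊔ y = y
T ⊔ y = T
B ⊔ F = B
B ⊔ B = B
B ⊔ _ = T
O ⊔ F = O
O ⊔ O = O
O ⊔ _ = T
N ⊔ F = N
N ⊔ N = N
N ⊔ _ = T

neg : M3 → M3
neg T = F
neg F = T
neg B = B
neg O = O
neg N = N

Valuation : Set
Valuation = ℕ → M3

⟦_⟧ : Formula → Valuation → M3
⟦ var p ⟧ v = v p
⟦ ¬' φ ⟧ v = neg (⟦ φ ⟧ v)
⟦ φ ∧' χ ⟧ v = ⟦ φ ⟧ v ⊓ ⟦ χ ⟧ v
⟦ φ ∨' χ ⟧ v = ⟦ φ ⟧ v ⊔ ⟦ χ ⟧ v

_⊨_ : Formula → Formula → Set
φ ⊨ χ = (v : Valuation) → ⟦ φ ⟧ v ≢ F → ⟦ χ ⟧ v ≢ F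

data Item : Set where
  𝔱 𝔪 𝔣 : Formula → Item
  _∼_ _≁_ : Formula → Formula → Item

-- A branch, regarded as a set (finite list, membership-based)
Branch : Set
Branch = List Item

data Closed (Γ : Branch) : Set where
  cl-tm : ∀ {φ} → 𝔱 φ ∈ Γ → 𝔪 φ ∈ Γ → Closed Γ
  cl-tf : ∀ {φ} → 𝔱 φ ∈ Γ → 𝔣 φ ∈ Γ → Closed Γ
  cl-mf : ∀ {φ} → 𝔪 φ ∈ Γ → 𝔣 φ ∈ Γ → Closed Γ
  cl-∼≁ : ∀ {φ χ} → (φ ∼ χ) ∈ Γ → (φ ≁ χ) ∈ Γ → Closed Γ
  cl-≁refl : ∀ {φ} → (φ ≁ φ) ∈ Γ → Closed Γ
  cl-four : ∀ {φ₁ φ₂ φ₃ φ₄} →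
    (φ₁ ≁ φ₂) ∈ Γ → (φ₁ ≁ φ₃) ∈ Γ → (φ₁ ≁ φ₄) ∈ Γ →
    (φ₂ ≁ φ₃) ∈ Γ → (φ₂ ≁ φ₄) ∈ Γ → (φ₃ ≁ φ₄) ∈ Γ → Closed Γ

-- Rule Γ Cs : some tableau rule has its premises on branch Γ and
-- its conclusions are the alternatives Cs (one list per split branch).
data Rule (Γ : Branch) : List (List Item) → Set where
  r-t∧ : ∀ {φ χ} → 𝔱 (φ ∧' χ) ∈ Γ →
    Rule Γ ((𝔱 φ ∷ 𝔱 χ ∷ []) ∷ [])
  r-t∨ : ∀ {φ χ} → 𝔱 (φ ∨' χ) ∈ Γ →
    Rule Γ ((𝔱 φ ∷ []) ∷ (𝔱 χ ∷ []) ∷ (𝔪 φ ∷ 𝔪 χ ∷ (φ ≁ χ) ∷ []) ∷ [])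
  r-t¬ : ∀ {φ} → 𝔱 (¬' φ) ∈ Γ →
    Rule Γ ((𝔣 φ ∷ []) ∷ [])
  r-m∧ : ∀ {φ χ} → 𝔪 (φ ∧' χ) ∈ Γ →
    Rule Γ ((𝔱 φ ∷ 𝔪 χ ∷ []) ∷ (𝔪 φ ∷ 𝔱 χ ∷ []) ∷ (𝔪 φ ∷ 𝔪 χ ∷ (φ ∼ χ) ∷ []) ∷ [])
  r-m∨ : ∀ {φ χ} → 𝔪 (φ ∨' χ) ∈ Γ →
    Rule Γ ((𝔣 φ ∷ 𝔪 χ ∷ []) ∷ (𝔪 φ ∷ 𝔣 χ ∷ []) ∷ (𝔪 φ ∷ 𝔪 χ ∷ (φ ∼ χ) ∷ []) ∷ [])
  r-m¬ : ∀ {φ} → 𝔪 (¬' φ) ∈ Γ →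
    Rule Γ ((𝔪 φ ∷ (φ ∼ (¬' φ)) ∷ []) ∷ [])
  r-f∧ : ∀ {φ χ} → 𝔣 (φ ∧' χ) ∈ Γ →
    Rule Γ ((𝔣 φ ∷ []) ∷ (𝔣 χ ∷ []) ∷ (𝔪 φ ∷ 𝔪 χ ∷ (φ ≁ χ) ∷ []) ∷ [])
  r-f∨ : ∀ {φ χ} → 𝔣 (φ ∨' χ) ∈ Γ →
    Rule Γ ((𝔣 φ ∷ 𝔣 χ ∷ []) ∷ [])
  r-f¬ : ∀ {φ} → 𝔣 (¬' φ) ∈ Γ →
    Rule Γ ((𝔱 φ ∷ []) ∷ [])
  r-∼sym : ∀ {φ χ} → (φ ∼ χ) ∈ Γ → Rule Γ (((χ ∼ φ) ∷ []) ∷ [])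
  r-≁sym : ∀ {φ χ} → (φ ≁ χ) ∈ Γ → Rule Γ (((χ ≁ φ) ∷ []) ∷ [])
  r-∼trans : ∀ {p q r} → (var p ∼ var q) ∈ Γ → (var q ∼ var r) ∈ Γ →
    Rule Γ (((var p ∼ var r) ∷ []) ∷ [])
  r-≁trans : ∀ {p q r} → (var p ≁ var q) ∈ Γ → (var q ∼ var r) ∈ Γ →
    Rule Γ (((var p ≁ var r) ∷ []) ∷ [])
  r-¬∼ : ∀ {φ χ} → ((¬' φ) ∼ χ) ∈ Γ → Rule Γ (((φ ∼ χ) ∷ []) ∷ [])
  r-¬≁ : ∀ {φ χ} → ((¬' φ) ≁ χ) ∈ Γ → Rule Γ (((φ ≁ χ) ∷ []) ∷ [])
  r-∧∼₁ : ∀ {φ χ₁ χ₂} → (φ ∼ (χ₁ ∧' χ₂)) ∈ Γ → 𝔪 χ₁ ∈ Γ → Rule Γ (((φ ∼ χ₁) ∷ []) ∷ [])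
  r-∧∼₂ : ∀ {φ χ₁ χ₂} → (φ ∼ (χ₁ ∧' χ₂)) ∈ Γ → 𝔪 χ₂ ∈ Γ → Rule Γ (((φ ∼ χ₂) ∷ []) ∷ [])
  r-∨∼₁ : ∀ {φ χ₁ χ₂} → (φ ∼ (χ₁ ∨' χ₂)) ∈ Γ → 𝔪 χ₁ ∈ Γ → Rule Γ (((φ ∼ χ₁) ∷ []) ∷ [])
  r-∨∼₂ : ∀ {φ χ₁ χ₂} → (φ ∼ (χ₁ ∨' χ₂)) ∈ Γ → 𝔪 χ₂ ∈ Γ → Rule Γ (((φ ∼ χ₂) ∷ []) ∷ [])
  r-∧≁₁ : ∀ {φ χ₁ χ₂} → (φ ≁ (χ₁ ∧' χ₂)) ∈ Γ → 𝔪 χ₁ ∈ Γ → Rule Γ (((φ ≁ χ₁) ∷ []) ∷ [])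
  r-∧≁₂ : ∀ {φ χ₁ χ₂} → (φ ≁ (χ₁ ∧' χ₂)) ∈ Γ → 𝔪 χ₂ ∈ Γ → Rule Γ (((φ ≁ χ₂) ∷ []) ∷ [])
  r-∨≁₁ : ∀ {φ χ₁ χ₂} → (φ ≁ (χ₁ ∨' χ₂)) ∈ Γ → 𝔪 χ₁ ∈ Γ → Rule Γ (((φ ≁ χ₁) ∷ []) ∷ [])
  r-∨≁₂ : ∀ {φ χ₁ χ₂} → (φ ≁ (χ₁ ∨' χ₂)) ∈ Γ → 𝔪 χ₂ ∈ Γ → Rule Γ (((φ ≁ χ₂) ∷ []) ∷ [])

data ClosedTableau (Γ : Branch) : Set where
  done : Closed Γ → ClosedTableau Γ
  step : ∀ {Cs} → Rule Γ Cs → All (λ C → ClosedTableau (C ++ Γ)) Cs → ClosedTableau Γ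

_⊢_ : Formula → Formula → Set
φ ⊢ χ = ClosedTableau (𝔪 φ ∷ 𝔣 χ ∷ []) × ClosedTableau (𝔱 φ ∷ 𝔣 χ ∷ [])

{-# OPTIONS --safe #-}
-- Read a branch as constraints on a valuation v: 𝔱, 𝔪, 𝔣 say that a formula takes
-- the value T, one of the three middles B, O, N, or F; φ ∼ χ and φ ≁ χ say that φ
-- and χ take equal, resp. distinct, middle values. Each rule sends a branch that v
-- satisfies to an alternative that v still satisfies, and no closed branch is
-- satisfiable (condition (4) by pigeonhole, since M3 has only three middles), so the
-- root of a closed tableau is unsatisfiable. A countermodel, v(φ) ≠ F = v(χ),
-- would satisfy one of the two roots {𝔪 φ, 𝔣 χ} and {𝔱 φ, 𝔣 χ}.
module Submission where

open import Defs
open import Data.Empty using (⊥; ⊥-elim)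
open import Data.Fin using (Fin; zero; suc; _<_)
open import Data.Fin.Properties using (pigeonhole)
open import Data.List using ([]; _∷_; _++_)
open import Data.List.Relation.Unary.All using (All; []; _∷_; lookup)
open import Data.List.Relation.Unary.All.Properties using (++⁺)
open import Data.List.Relation.Unary.Any using (Any; here; there)
open import Data.Nat using (_≤_; s≤s)
open import Data.Nat.Properties using (≮⇒≥; 1+n≰n)
open import Data.Product using (_×_; _,_; proj₁; proj₂)
open import Data.Sum using (_⊎_; inj₁; inj₂)
open import Data.Vec as Vec using (Vec)
open import Data.Vec.Relation.Unary.All as VecAll using ([]; _∷_)
open import Data.Vec.Relation.Unary.All.Properties using (lookup⁺)
open import Data.Vec.Relation.Unary.AllPairs using (AllPairs; []; _∷_)
open import Relation.Binary.PropositionalEquality using (_≡_; _≢_; refl; sym; trans; subst)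

data Middle : M3 → Set where
  mB : Middle B
  mO : Middle O
  mN : Middle N

SameMiddle : M3 → M3 → Set
SameMiddle a b = Middle a × a ≡ b

DistinctMiddles : M3 → M3 → Set
DistinctMiddles a b = Middle a × Middle b × a ≢ b

trichotomy : ∀ a → a ≡ T ⊎ Middle a ⊎ a ≡ F
trichotomy T = inj₁ refl
trichotomy B = inj₂ (inj₁ mB)
trichotomy O = inj₂ (inj₁ mO)
trichotomy N = inj₂ (inj₁ mN)
trichotomy F = inj₂ (inj₂ refl)

middle≢T : ∀ {a} → Middle a → a ≢ T
middle≢T mB ()
middle≢T mO ()
middle≢T mN ()

middle≢F : ∀ {a} → Middle a → a ≢ F
middle≢F mB ()
middle≢F mO ()
middle≢F mN ()

middle-index : ∀ {a} → Middle a → Fin 3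
middle-index mB = zero
middle-index mO = suc zero
middle-index mN = suc (suc zero)

middle-index-injective : ∀ {a b} (ma : Middle a) (mb : Middle b) →
  middle-index ma ≡ middle-index mb → a ≡ b
middle-index-injective mB mB _ = refl
middle-index-injective mO mO _ = refl
middle-index-injective mN mN _ = refl
middle-index-injective mB mO ()
middle-index-injective mB mN ()
middle-index-injective mO mB ()
middle-index-injective mO mN ()
middle-index-injective mN mB ()
middle-index-injective mN mO ()

AllPairs-lookup⁺ : ∀ {A : Set} {R : A → A → Set} {n} {xs : Vec A n} →
  AllPairs R xs → ∀ {i j : Fin n} → i < j → R (Vec.lookup xs i) (Vec.lookup xs j)
AllPairs-lookup⁺ (Rx ∷ _)  {zero}  {suc j} _         = lookup⁺ Rx j
AllPairs-lookup⁺ (_ ∷ Rxs) {suc i} {suc j} (s≤s i<j) = AllPairs-lookup⁺ Rxs i<j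

distinct-middles-length≤3 : ∀ {n} {xs : Vec M3 n} →
  VecAll.All Middle xs → AllPairs _≢_ xs → n ≤ 3
distinct-middles-length≤3 middle distinct = ≮⇒≥ λ 3<n →
  let i , j , i<j , same-index = pigeonhole 3<n (λ i → middle-index (lookup⁺ middle i))
  in AllPairs-lookup⁺ distinct i<j
       (middle-index-injective (lookup⁺ middle i) (lookup⁺ middle j) same-index)

infix 4 _⊩_ _⊩*_

_⊩_ : Valuation → Item → Set
v ⊩ 𝔱 φ   = ⟦ φ ⟧ v ≡ T
v ⊩ 𝔪 φ   = Middle (⟦ φ ⟧ v)
v ⊩ 𝔣 φ   = ⟦ φ ⟧ v ≡ F
v ⊩ φ ∼ χ = SameMiddle (⟦ φ ⟧ v) (⟦ χ ⟧ v)
v ⊩ φ ≁ χ = DistinctMiddles (⟦ φ ⟧ v) (⟦ χ ⟧ v)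

_⊩*_ : Valuation → Branch → Set
v ⊩* Γ = All (v ⊩_) Γ

closed⇒unsatisfiable : ∀ {Γ} v → v ⊩* Γ → Closed Γ → ⊥
closed⇒unsatisfiable v sat (cl-tm t m) = middle≢T (lookup sat m) (lookup sat t)
closed⇒unsatisfiable v sat (cl-tf t f) with () ← trans (sym (lookup sat t)) (lookup sat f)
closed⇒unsatisfiable v sat (cl-mf m f) = middle≢F (lookup sat m) (lookup sat f)
closed⇒unsatisfiable v sat (cl-∼≁ s d) =
  let _ , equal = lookup sat s ; _ , _ , unequal = lookup sat d in unequal equal
closed⇒unsatisfiable v sat (cl-≁refl d) = let _ , _ , unequal = lookup sat d in unequal refl
closed⇒unsatisfiable v sat (cl-four d₁₂ d₁₃ d₁₄ d₂₃ d₂₄ d₃₄) =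
  let m₁ , m₂ , n₁₂ = lookup sat d₁₂
      _  , m₃ , n₁₃ = lookup sat d₁₃
      _  , m₄ , n₁₄ = lookup sat d₁₄
      _  , _  , n₂₃ = lookup sat d₂₃
      _  , _  , n₂₄ = lookup sat d₂₄
      _  , _  , n₃₄ = lookup sat d₃₄
  in 1+n≰n (distinct-middles-length≤3 (m₁ ∷ m₂ ∷ m₃ ∷ m₄ ∷ [])
       ((n₁₂ ∷ n₁₃ ∷ n₁₄ ∷ []) ∷ (n₂₃ ∷ n₂₄ ∷ []) ∷ (n₃₄ ∷ []) ∷ [] ∷ []))

⊓≡T : ∀ a b → a ⊓ b ≡ T → a ≡ T × b ≡ T
⊓≡T T b b≡T = refl , b≡T
⊓≡T F b ()
⊓≡T B T ()
⊓≡T B B ()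
⊓≡T B O ()
⊓≡T B N ()
⊓≡T B F ()
⊓≡T O T ()
⊓≡T O B ()
⊓≡T O O ()
⊓≡T O N ()
⊓≡T O F ()
⊓≡T N T ()
⊓≡T N B ()
⊓≡T N O ()
⊓≡T N N ()
⊓≡T N F ()

⊔≡F : ∀ a b → a ⊔ b ≡ F → a ≡ F × b ≡ F
⊔≡F F b b≡F = refl , b≡F
⊔≡F T b ()
⊔≡F B T ()
⊔≡F B B ()
⊔≡F B O ()
⊔≡F B N ()
⊔≡F B F ()
⊔≡F O T ()
⊔≡F O B ()
⊔≡F O O ()
⊔≡F O N ()
⊔≡F O F ()
⊔≡F N T ()
⊔≡F N B ()
⊔≡F N O ()
⊔≡F N N ()
⊔≡F N F ()

⊓≡F : ∀ a b → a ⊓ b ≡ F → a ≡ F ⊎ b ≡ F ⊎ DistinctMiddles a b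
⊓≡F F b _   = inj₁ refl
⊓≡F T b b≡F = inj₂ (inj₁ b≡F)
⊓≡F B F _   = inj₂ (inj₁ refl)
⊓≡F O F _   = inj₂ (inj₁ refl)
⊓≡F N F _   = inj₂ (inj₁ refl)
⊓≡F B O _   = inj₂ (inj₂ (mB , mO , λ ()))
⊓≡F B N _   = inj₂ (inj₂ (mB , mN , λ ()))
⊓≡F O B _   = inj₂ (inj₂ (mO , mB , λ ()))
⊓≡F O N _   = inj₂ (inj₂ (mO , mN , λ ()))
⊓≡F N B _   = inj₂ (inj₂ (mN , mB , λ ()))
⊓≡F N O _   = inj₂ (inj₂ (mN , mO , λ ()))
⊓≡F B T ()
⊓≡F B B ()
⊓≡F O T ()
⊓≡F O O ()
⊓≡F N T ()
⊓≡F N N ()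

⊔≡T : ∀ a b → a ⊔ b ≡ T → a ≡ T ⊎ b ≡ T ⊎ DistinctMiddles a b
⊔≡T T b _   = inj₁ refl
⊔≡T F b b≡T = inj₂ (inj₁ b≡T)
⊔≡T B T _   = inj₂ (inj₁ refl)
⊔≡T O T _   = inj₂ (inj₁ refl)
⊔≡T N T _   = inj₂ (inj₁ refl)
⊔≡T B O _   = inj₂ (inj₂ (mB , mO , λ ()))
⊔≡T B N _   = inj₂ (inj₂ (mB , mN , λ ()))
⊔≡T O B _   = inj₂ (inj₂ (mO , mB , λ ()))
⊔≡T O N _   = inj₂ (inj₂ (mO , mN , λ ()))
⊔≡T N B _   = inj₂ (inj₂ (mN , mB , λ ()))
⊔≡T N O _   = inj₂ (inj₂ (mN , mO , λ ()))
⊔≡T B F ()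
⊔≡T B B ()
⊔≡T O F ()
⊔≡T O O ()
⊔≡T N F ()
⊔≡T N N ()

⊓-middle-inv : ∀ a b → Middle (a ⊓ b) →
  (a ≡ T × a ⊓ b ≡ b) ⊎ (b ≡ T × a ⊓ b ≡ a) ⊎ (a ≡ b × a ⊓ b ≡ a)
⊓-middle-inv T b _ = inj₁ (refl , refl)
⊓-middle-inv F b ()
⊓-middle-inv B T _ = inj₂ (inj₁ (refl , refl))
⊓-middle-inv O T _ = inj₂ (inj₁ (refl , refl))
⊓-middle-inv N T _ = inj₂ (inj₁ (refl , refl))
⊓-middle-inv B B _ = inj₂ (inj₂ (refl , refl))
⊓-middle-inv O O _ = inj₂ (inj₂ (refl , refl))
⊓-middle-inv N N _ = inj₂ (inj₂ (refl , refl))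
⊓-middle-inv B O ()
⊓-middle-inv B N ()
⊓-middle-inv B F ()
⊓-middle-inv O B ()
⊓-middle-inv O N ()
⊓-middle-inv O F ()
⊓-middle-inv N B ()
⊓-middle-inv N O ()
⊓-middle-inv N F ()

⊔-middle-inv : ∀ a b → Middle (a ⊔ b) →
  (a ≡ F × a ⊔ b ≡ b) ⊎ (b ≡ F × a ⊔ b ≡ a) ⊎ (a ≡ b × a ⊔ b ≡ a)
⊔-middle-inv F b _ = inj₁ (refl , refl)
⊔-middle-inv T b ()
⊔-middle-inv B F _ = inj₂ (inj₁ (refl , refl))
⊔-middle-inv O F _ = inj₂ (inj₁ (refl , refl))
⊔-middle-inv N F _ = inj₂ (inj₁ (refl , refl))
⊔-middle-inv B B _ = inj₂ (inj₂ (refl , refl))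
⊔-middle-inv O O _ = inj₂ (inj₂ (refl , refl))
⊔-middle-inv N N _ = inj₂ (inj₂ (refl , refl))
⊔-middle-inv B O ()
⊔-middle-inv B N ()
⊔-middle-inv B T ()
⊔-middle-inv O B ()
⊔-middle-inv O N ()
⊔-middle-inv O T ()
⊔-middle-inv N B ()
⊔-middle-inv N O ()
⊔-middle-inv N T ()

neg≡T : ∀ a → neg a ≡ T → a ≡ F
neg≡T F _ = refl
neg≡T T ()
neg≡T B ()
neg≡T O ()
neg≡T N ()

neg≡F : ∀ a → neg a ≡ F → a ≡ T
neg≡F T _ = refl
neg≡F F ()
neg≡F B ()
neg≡F O ()
neg≡F N ()

neg-middle : ∀ a → Middle (neg a) → neg a ≡ a
neg-middle B _ = refl
neg-middle O _ = refl
neg-middle N _ = refl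
neg-middle T ()
neg-middle F ()

⊓-middle-cases : ∀ a b → Middle (a ⊓ b) →
  (a ≡ T × Middle b) ⊎ (Middle a × b ≡ T) ⊎ (Middle a × Middle b × SameMiddle a b)
⊓-middle-cases a b m with ⊓-middle-inv a b m
... | inj₁ (a≡T , e)         = inj₁ (a≡T , subst Middle e m)
... | inj₂ (inj₁ (b≡T , e))  = inj₂ (inj₁ (subst Middle e m , b≡T))
... | inj₂ (inj₂ (refl , e)) = let ma = subst Middle e m in inj₂ (inj₂ (ma , ma , ma , refl))

⊔-middle-cases : ∀ a b → Middle (a ⊔ b) →
  (a ≡ F × Middle b) ⊎ (Middle a × b ≡ F) ⊎ (Middle a × Middle b × SameMiddle a b)
⊔-middle-cases a b m with ⊔-middle-inv a b m
... | inj₁ (a≡F , e)         = inj₁ (a≡F , subst Middle e m)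
... | inj₂ (inj₁ (b≡F , e))  = inj₂ (inj₁ (subst Middle e m , b≡F))
... | inj₂ (inj₂ (refl , e)) = let ma = subst Middle e m in inj₂ (inj₂ (ma , ma , ma , refl))

⊓-middle⇒≡ˡ : ∀ a b → Middle a → Middle (a ⊓ b) → a ⊓ b ≡ a
⊓-middle⇒≡ˡ a b ma m with ⊓-middle-inv a b m
... | inj₁ (refl , _)     = ⊥-elim (middle≢T ma refl)
... | inj₂ (inj₁ (_ , e)) = e
... | inj₂ (inj₂ (_ , e)) = e

⊓-middle⇒≡ʳ : ∀ a b → Middle b → Middle (a ⊓ b) → a ⊓ b ≡ b
⊓-middle⇒≡ʳ a b mb m with ⊓-middle-inv a b m
... | inj₁ (_ , e)           = e
... | inj₂ (inj₁ (refl , _)) = ⊥-elim (middle≢T mb refl)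
... | inj₂ (inj₂ (refl , e)) = e

⊔-middle⇒≡ˡ : ∀ a b → Middle a → Middle (a ⊔ b) → a ⊔ b ≡ a
⊔-middle⇒≡ˡ a b ma m with ⊔-middle-inv a b m
... | inj₁ (refl , _)     = ⊥-elim (middle≢F ma refl)
... | inj₂ (inj₁ (_ , e)) = e
... | inj₂ (inj₂ (_ , e)) = e

⊔-middle⇒≡ʳ : ∀ a b → Middle b → Middle (a ⊔ b) → a ⊔ b ≡ b
⊔-middle⇒≡ʳ a b mb m with ⊔-middle-inv a b m
... | inj₁ (_ , e)           = e
... | inj₂ (inj₁ (refl , _)) = ⊥-elim (middle≢F mb refl)
... | inj₂ (inj₂ (refl , e)) = e

SameMiddle-sym : ∀ {a b} → SameMiddle a b → SameMiddle b a
SameMiddle-sym (ma , refl) = ma , refl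

DistinctMiddles-sym : ∀ {a b} → DistinctMiddles a b → DistinctMiddles b a
DistinctMiddles-sym (ma , mb , a≢b) = mb , ma , λ b≡a → a≢b (sym b≡a)

SameMiddle-transportˡ : ∀ {a b c} → (Middle a → a ≡ c) → SameMiddle a b → SameMiddle c b
SameMiddle-transportˡ a≡c (ma , refl) with refl ← a≡c ma = ma , refl

SameMiddle-transportʳ : ∀ {a b c} → (Middle b → b ≡ c) → SameMiddle a b → SameMiddle a c
SameMiddle-transportʳ b≡c (ma , refl) = ma , b≡c ma

DistinctMiddles-transportˡ : ∀ {a b c} → (Middle a → a ≡ c) → DistinctMiddles a b → DistinctMiddles c b
DistinctMiddles-transportˡ a≡c (ma , mb , a≢b) with refl ← a≡c ma = ma , mb , a≢b

DistinctMiddles-transportʳ : ∀ {a b c} → (Middle b → b ≡ c) → DistinctMiddles a b → DistinctMiddles a c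
DistinctMiddles-transportʳ b≡c (ma , mb , a≢b) with refl ← b≡c mb = ma , mb , a≢b

rule-sound : ∀ {Γ Cs} v → v ⊩* Γ → Rule Γ Cs → Any (v ⊩*_) Cs
rule-sound v sat (r-t∧ p) = let φ≡T , χ≡T = ⊓≡T _ _ (lookup sat p) in here (φ≡T ∷ χ≡T ∷ [])
rule-sound v sat (r-t∨ p) with ⊔≡T _ _ (lookup sat p)
... | inj₁ φ≡T                    = here (φ≡T ∷ [])
... | inj₂ (inj₁ χ≡T)             = there (here (χ≡T ∷ []))
... | inj₂ (inj₂ d@(mφ , mχ , _)) = there (there (here (mφ ∷ mχ ∷ d ∷ [])))
rule-sound v sat (r-t¬ p) = here (neg≡T _ (lookup sat p) ∷ [])
rule-sound v sat (r-m∧ p) with ⊓-middle-cases _ _ (lookup sat p)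
... | inj₁ (φ≡T , mχ)           = here (φ≡T ∷ mχ ∷ [])
... | inj₂ (inj₁ (mφ , χ≡T))    = there (here (mφ ∷ χ≡T ∷ []))
... | inj₂ (inj₂ (mφ , mχ , s)) = there (there (here (mφ ∷ mχ ∷ s ∷ [])))
rule-sound v sat (r-m∨ p) with ⊔-middle-cases _ _ (lookup sat p)
... | inj₁ (φ≡F , mχ)           = here (φ≡F ∷ mχ ∷ [])
... | inj₂ (inj₁ (mφ , χ≡F))    = there (here (mφ ∷ χ≡F ∷ []))
... | inj₂ (inj₂ (mφ , mχ , s)) = there (there (here (mφ ∷ mχ ∷ s ∷ [])))
rule-sound v sat (r-m¬ p) =
  let s = SameMiddle-transportˡ (neg-middle _) (lookup sat p , refl)
  in here (proj₁ s ∷ s ∷ [])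
rule-sound v sat (r-f∧ p) with ⊓≡F _ _ (lookup sat p)
... | inj₁ φ≡F                    = here (φ≡F ∷ [])
... | inj₂ (inj₁ χ≡F)             = there (here (χ≡F ∷ []))
... | inj₂ (inj₂ d@(mφ , mχ , _)) = there (there (here (mφ ∷ mχ ∷ d ∷ [])))
rule-sound v sat (r-f∨ p) = let φ≡F , χ≡F = ⊔≡F _ _ (lookup sat p) in here (φ≡F ∷ χ≡F ∷ [])
rule-sound v sat (r-f¬ p) = here (neg≡F _ (lookup sat p) ∷ [])
rule-sound v sat (r-∼sym p) = here (SameMiddle-sym (lookup sat p) ∷ [])
rule-sound v sat (r-≁sym p) = here (DistinctMiddles-sym (lookup sat p) ∷ [])
rule-sound v sat (r-∼trans p q) =
  here (subst (SameMiddle _) (proj₂ (lookup sat q)) (lookup sat p) ∷ [])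
rule-sound v sat (r-≁trans p q) =
  here (subst (DistinctMiddles _) (proj₂ (lookup sat q)) (lookup sat p) ∷ [])
rule-sound v sat (r-¬∼ p) =
  here (SameMiddle-transportˡ (neg-middle _) (lookup sat p) ∷ [])
rule-sound v sat (r-¬≁ p) =
  here (DistinctMiddles-transportˡ (neg-middle _) (lookup sat p) ∷ [])
rule-sound v sat (r-∧∼₁ p m) =
  here (SameMiddle-transportʳ (⊓-middle⇒≡ˡ _ _ (lookup sat m)) (lookup sat p) ∷ [])
rule-sound v sat (r-∧∼₂ p m) =
  here (SameMiddle-transportʳ (⊓-middle⇒≡ʳ _ _ (lookup sat m)) (lookup sat p) ∷ [])
rule-sound v sat (r-∨∼₁ p m) =
  here (SameMiddle-transportʳ (⊔-middle⇒≡ˡ _ _ (lookup sat m)) (lookup sat p) ∷ [])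
rule-sound v sat (r-∨∼₂ p m) =
  here (SameMiddle-transportʳ (⊔-middle⇒≡ʳ _ _ (lookup sat m)) (lookup sat p) ∷ [])
rule-sound v sat (r-∧≁₁ p m) =
  here (DistinctMiddles-transportʳ (⊓-middle⇒≡ˡ _ _ (lookup sat m)) (lookup sat p) ∷ [])
rule-sound v sat (r-∧≁₂ p m) =
  here (DistinctMiddles-transportʳ (⊓-middle⇒≡ʳ _ _ (lookup sat m)) (lookup sat p) ∷ [])
rule-sound v sat (r-∨≁₁ p m) =
  here (DistinctMiddles-transportʳ (⊔-middle⇒≡ˡ _ _ (lookup sat m)) (lookup sat p) ∷ [])
rule-sound v sat (r-∨≁₂ p m) =
  here (DistinctMiddles-transportʳ (⊔-middle⇒≡ʳ _ _ (lookup sat m)) (lookup sat p) ∷ [])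

mutual
  closedTableau⇒unsatisfiable : ∀ {Γ} v → v ⊩* Γ → ClosedTableau Γ → ⊥
  closedTableau⇒unsatisfiable v sat (done closed) = closed⇒unsatisfiable v sat closed
  closedTableau⇒unsatisfiable v sat (step rule tableaux) =
    closedTableaux⇒unsatisfiable v sat (rule-sound v sat rule) tableaux

  closedTableaux⇒unsatisfiable : ∀ {Γ Cs} v → v ⊩* Γ → Any (v ⊩*_) Cs →
    All (λ C → ClosedTableau (C ++ Γ)) Cs → ⊥
  closedTableaux⇒unsatisfiable v sat (here satC) (tableau ∷ _) =
    closedTableau⇒unsatisfiable v (++⁺ satC sat) tableau
  closedTableaux⇒unsatisfiable v sat (there satCs) (_ ∷ tableaux) =
    closedTableaux⇒unsatisfiable v sat satCs tableaux

theorem3 : (φ χ : Formula) → φ ⊢ χ → φ ⊨ χ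
theorem3 φ χ (m-tableau , t-tableau) v φ≢F χ≡F with trichotomy (⟦ φ ⟧ v)
... | inj₁ φ≡T          = closedTableau⇒unsatisfiable v (φ≡T ∷ χ≡F ∷ []) t-tableau
... | inj₂ (inj₁ φ-mid) = closedTableau⇒unsatisfiable v (φ-mid ∷ χ≡F ∷ []) m-tableau
... | inj₂ (inj₂ φ≡F)   = φ≢F φ≡F
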